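{- Let $t\ge1$ be an integer such that a $(4t-1,2t-1,t-1)$ skew-Hadamard design exists. Then for every integer $m\ge2$ there exists a $2t$-resolvable semi-regular self-dual rectangular design with parameters $v=b=m(4t-1)$, $r=k=2mt$, $\lambda_1=mt$, $\lambda_2=2t(m-2)+2$, $\lambda_3=mt+1$, $m$, $n=4t-1$.
   Context: A $(4t-1,2t-1,t-1)$ skew-Hadamard design is a symmetric design on $4t-1$ treatments with blocks of size $2t-1$, any two treatments together in $t-1$ blocks, whose incidence matrix $N$ satisfies $N+N^T=J-I$. A rectangular design (RD) with parameters $v=mn,b,r,k,\lambda_1,\lambda_2,\lambda_3,m,n$ has its treatments arranged in an $m\times n$ array, $b$ blocks of size $k$, replication $r$, and any two distinct treatments occur together in $\lambda_1$ blocks if in the same row, $\lambda_2$ if in the same column, $\lambda_3$ otherwise. It is self-dual if the design with transposed incidence matrix is an RD with the same parameters. With $\theta_1=r-\lambda_1+(m-1)(\lambda_2-\lambda_3)$, $\theta_2=r-\lambda_2+(n-1)(\lambda_1-\lambda_3)$, $\theta_3=r-\lambda_1-\lambda_2+\lambda_3$, it is semi-regular if exactly one of $\theta_1,\theta_2$ is $0$ and the remaining $\theta$'s are positive. A design is $\alpha$-resolvable if its blocks can be partitioned into classes such that each treatment occurs in exactly $\alpha$ blocks of each class. -}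

module Defs where

open import Data.Nat using (ℕ; zero; suc; _+_; _*_; _∸_; _≤_)
open import Data.Bool using (Bool; true; false; _∧_)
open import Data.Fin using (Fin; zero; suc; remQuot)
open import Data.Product using (Σ; _×_; _,_; proj₁; proj₂; ∃)
open import Data.Sum using (_⊎_)
open import Data.Integer as ℤ using (ℤ; +_; +[1+_])
open import Relation.Binary.PropositionalEquality using (_≡_; _≢_)
open import Function.Bundles using (_↔_; Inverse)

b2n : Bool → ℕ
b2n true  = 1
b2n false = 0

count : ∀ {n} → (Fin n → Bool) → ℕ
count {zero}  f = 0
count {suc n} f = b2n (f zero) + count (λ i → f (suc i))

-- Skew-Hadamard (4t-1, 2t-1, t-1) design.
-- Incidence N x B = true iff treatment x lies in block B; treatments and
-- blocks are both indexed by Fin (4t-1) (a symmetric design has b = v).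

IsSkewHadamard : (t : ℕ) → (Fin (4 * t ∸ 1) → Fin (4 * t ∸ 1) → Bool) → Set
IsSkewHadamard t N =
    (∀ B → count (λ x → N x B) ≡ 2 * t ∸ 1)
  ×
    (∀ x y → x ≢ y → count (λ B → N x B ∧ N y B) ≡ t ∸ 1)
  × -- N + Nᵀ = J - I
    (∀ x → b2n (N x x) + b2n (N x x) ≡ 0)
  × (∀ x y → x ≢ y → b2n (N x y) + b2n (N y x) ≡ 1)

SkewHadamardExists : ℕ → Set
SkewHadamardExists t = Σ (Fin (4 * t ∸ 1) → Fin (4 * t ∸ 1) → Bool) (IsSkewHadamard t)

-- Rectangular designs. Treatments are the cells (i , j) of an m × n array
-- (row i, column j); blocks are indexed by Fin b.

Incidence : ℕ → ℕ → ℕ → Set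
Incidence m n b = Fin m × Fin n → Fin b → Bool

blockSize : ∀ {m n b} → Incidence m n b → Fin b → ℕ
blockSize {m} {n} N B = sumFin (λ i → count (λ j → N (i , j) B))
  where
  sumFin : ∀ {k} → (Fin k → ℕ) → ℕ
  sumFin {zero}  f = 0
  sumFin {suc k} f = f zero + sumFin (λ i → f (suc i))

replication : ∀ {m n b} → Incidence m n b → Fin m × Fin n → ℕ
replication N x = count (λ B → N x B)

concurrence : ∀ {m n b} → Incidence m n b → Fin m × Fin n → Fin m × Fin n → ℕ
concurrence N x y = count (λ B → N x B ∧ N y B)

IsRD : (m n b r k λ₁ λ₂ λ₃ : ℕ) → Incidence m n b → Set
IsRD m n b r k λ₁ λ₂ λ₃ N =
    (∀ x → replication N x ≡ r)
  × (∀ B → blockSize N B ≡ k)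
  ×
    (∀ i j j′ → j ≢ j′ → concurrence N (i , j) (i , j′) ≡ λ₁)
  ×
    (∀ i i′ j → i ≢ i′ → concurrence N (i , j) (i′ , j) ≡ λ₂)
  ×
    (∀ i i′ j j′ → i ≢ i′ → j ≢ j′ → concurrence N (i , j) (i′ , j′) ≡ λ₃)

-- Dual design: the blocks of N become treatments, arranged in the m × n
-- array via the bijection σ; the treatments of N become the blocks,
-- relabelled by Fin (m * n) through the standard bijection remQuot.
dual : ∀ {m n b} → Incidence m n b → (σ : (Fin m × Fin n) ↔ Fin b) → Incidence m n (m * n)
dual {m} {n} N σ p q = N (remQuot {m} n q) (Inverse.to σ p)

IsSelfDualRD : (m n b r k λ₁ λ₂ λ₃ : ℕ) → Incidence m n b → Set
IsSelfDualRD m n b r k λ₁ λ₂ λ₃ N =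
  IsRD m n b r k λ₁ λ₂ λ₃ N
  × b ≡ m * n
  × Σ ((Fin m × Fin n) ↔ Fin b) (λ σ → IsRD m n (m * n) r k λ₁ λ₂ λ₃ (dual N σ))

θ₁ θ₂ θ₃ : (m n r λ₁ λ₂ λ₃ : ℕ) → ℤ
θ₁ m n r λ₁ λ₂ λ₃ = (+ r ℤ.- + λ₁) ℤ.+ (+ m ℤ.- + 1) ℤ.* (+ λ₂ ℤ.- + λ₃)
θ₂ m n r λ₁ λ₂ λ₃ = (+ r ℤ.- + λ₂) ℤ.+ (+ n ℤ.- + 1) ℤ.* (+ λ₁ ℤ.- + λ₃)
θ₃ m n r λ₁ λ₂ λ₃ = ((+ r ℤ.- + λ₁) ℤ.- + λ₂) ℤ.+ + λ₃

IsSemiRegular : (m n r λ₁ λ₂ λ₃ : ℕ) → Set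
IsSemiRegular m n r λ₁ λ₂ λ₃ =
    (θ₁ m n r λ₁ λ₂ λ₃ ≡ + 0 × + 0 ℤ.< θ₂ m n r λ₁ λ₂ λ₃ × + 0 ℤ.< θ₃ m n r λ₁ λ₂ λ₃)
  ⊎ (θ₂ m n r λ₁ λ₂ λ₃ ≡ + 0 × + 0 ℤ.< θ₁ m n r λ₁ λ₂ λ₃ × + 0 ℤ.< θ₃ m n r λ₁ λ₂ λ₃)

IsResolvable : ∀ {m n b} → ℕ → Incidence m n b → Set
IsResolvable {m} {n} {b} α N =
  Σ ℕ λ s → Σ (Fin b → Fin s) λ cls →
    ∀ (c : Fin s) x → count (λ B → N x B ∧ isClass cls c B) ≡ α
  where
  open import Data.Fin using (_≟_)
  open import Relation.Nullary.Decidable using (⌊_⌋)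
  isClass : ∀ {s} → (Fin b → Fin s) → Fin s → Fin b → Bool
  isClass cls c B = ⌊ cls B ≟ c ⌋

-- Let N be the incidence matrix of the skew-Hadamard design and take the m × m block matrix with
-- N + I on the diagonal blocks and J − N elsewhere, i.e. I_m ⊗ (N + I) + (J_m − I_m) ⊗ (J − N).
-- Since N + Nᵀ = J − I, we have N + I = J − Nᵀ, so every row and column of both blocks has 2t
-- ones, two distinct rows of N + I (or of J − N) meet in t places, row j of N + I meets row j of
-- J − N only in column j, and for j ≠ j′ the two mixed inner products add up to 2t + 1.
-- Summing these block by block over the m block rows gives λ₁ = mt, λ₂ = 2 + 2t(m − 2) and
-- λ₃ = 2t + 1 + t(m − 2), and the m block columns are the classes of a 2t-resolution. The transposed
-- matrix is the same construction applied to Nᵀ, which is again skew-Hadamard, so the design is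
-- self-dual; θ₂ = 0 < θ₁, θ₃ is arithmetic.

module Submission where

open import Defs
open import Data.Bool using (Bool; true; false; _∧_; _∨_; not; if_then_else_)
open import Data.Bool.Properties
  using (∧-comm; ∧-idem; ∧-identityʳ; ∧-zeroʳ; ∨-identityʳ; not-involutive; ∨-∧-booleanAlgebra)
open import Algebra.Lattice.Properties.BooleanAlgebra ∨-∧-booleanAlgebra using (deMorgan₂)
open import Data.Empty using (⊥-elim)
open import Data.Fin using (Fin; zero; suc; _≟_; punchIn; punchOut; remQuot; _↑ˡ_; _↑ʳ_)
open import Data.Fin.Properties
  using (*↔×; remQuot-combine; punchInᵢ≢i; punchIn-injective; punchIn-punchOut; splitAt-↑ˡ; splitAt-↑ʳ)
open import Data.Integer as ℤ using (ℤ; +<+) renaming (+_ to pos)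
open import Data.Integer.Properties using (pos-+; pos-*)
import Data.Integer.Tactic.RingSolver as ℤ-Solver
open import Data.Nat using (ℕ; zero; suc; _+_; _*_; _∸_; _≤_; pred; s≤s; z≤n)
open import Data.Nat.Properties
  using (+-assoc; +-suc; +-identityʳ; *-zeroʳ; +-cancelʳ-≡; +-commutativeSemigroup; +-0-commutativeMonoid)
open import Data.Nat.Tactic.RingSolver using (solve-∀)
open import Algebra.Properties.CommutativeMonoid.Sum +-0-commutativeMonoid using (sum; sum-cong-≗; sum-remove)
open import Algebra.Properties.CommutativeSemigroup +-commutativeSemigroup using (interchange)
open import Data.Product using (Σ; _×_; _,_; proj₁; proj₂)
open import Data.Sum using (inj₂)
open import Function using (_∘_; flip)
open import Function.Properties.Inverse using (↔-sym)
open import Relation.Binary.PropositionalEquality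
open import Relation.Nullary using (does; yes; no)
open import Relation.Nullary.Decidable using (dec-true; dec-false; isYes; isYes≗does)

private
  variable
    m n : ℕ

-- Counting

count-cong : {f g : Fin n → Bool} → (∀ x → f x ≡ g x) → count f ≡ count g
count-cong {zero}  f≗g = refl
count-cong {suc n} f≗g = cong₂ _+_ (cong b2n (f≗g zero)) (count-cong (f≗g ∘ suc))

count-false : count {n} (λ _ → false) ≡ 0
count-false {zero}  = refl
count-false {suc n} = count-false {n}

count-+-pointwise : {f g h k : Fin n → Bool} →
  (∀ x → b2n (f x) + b2n (g x) ≡ b2n (h x) + b2n (k x)) →
  count f + count g ≡ count h + count k
count-+-pointwise {zero}  eq = refl
count-+-pointwise {suc n} {f} {g} {h} {k} eq = begin
  (b2n (f zero) + count (f ∘ suc)) + (b2n (g zero) + count (g ∘ suc))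
    ≡⟨ interchange (b2n (f zero)) _ _ _ ⟩
  (b2n (f zero) + b2n (g zero)) + (count (f ∘ suc) + count (g ∘ suc))
    ≡⟨ cong₂ _+_ (eq zero) (count-+-pointwise (eq ∘ suc)) ⟩
  (b2n (h zero) + b2n (k zero)) + (count (h ∘ suc) + count (k ∘ suc))
    ≡⟨ interchange (b2n (h zero)) _ _ _ ⟨
  (b2n (h zero) + count (h ∘ suc)) + (b2n (k zero) + count (k ∘ suc)) ∎
  where open ≡-Reasoning

count-∨-∧ : (f g : Fin n → Bool) →
  count (λ x → f x ∨ g x) + count (λ x → f x ∧ g x) ≡ count f + count g
count-∨-∧ f g = count-+-pointwise λ x → pointwise (f x) (g x)
  where
  pointwise : ∀ a b → b2n (a ∨ b) + b2n (a ∧ b) ≡ b2n a + b2n b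
  pointwise true  true  = refl
  pointwise true  false = refl
  pointwise false true  = refl
  pointwise false false = refl

count-not : (f : Fin n → Bool) → count (λ x → not (f x)) + count f ≡ n
count-not {zero}  f = refl
count-not {suc n} f with f zero
... | true  = trans (+-suc _ _) (cong suc (count-not (f ∘ suc)))
... | false = cong suc (count-not (f ∘ suc))

count-∧-not : (f g : Fin n → Bool) →
  count (λ x → f x ∧ not (g x)) + count (λ x → f x ∧ g x) ≡ count f
count-∧-not {n} f g = begin
  count (λ x → f x ∧ not (g x)) + count (λ x → f x ∧ g x)
    ≡⟨ count-+-pointwise {k = λ _ → false} (λ x → pointwise (f x) (g x)) ⟩
  count f + count {n} (λ _ → false)  ≡⟨ cong (count f +_) (count-false {n}) ⟩
  count f + 0                        ≡⟨ +-identityʳ _ ⟩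
  count f                            ∎
  where
  open ≡-Reasoning
  pointwise : ∀ a b → b2n (a ∧ not b) + b2n (a ∧ b) ≡ b2n a + b2n false
  pointwise true  true  = refl
  pointwise true  false = refl
  pointwise false b     = refl

-- Indicators use `does` rather than ⌊_⌋ (= isYes), which does not compute on `suc j ≟ suc x`.
count-≟-∧ : (j : Fin n) (g : Fin n → Bool) → count (λ x → does (j ≟ x) ∧ g x) ≡ b2n (g j)
count-≟-∧ {suc n} zero    g = trans (cong (b2n (g zero) +_) (count-false {n})) (+-identityʳ _)
count-≟-∧ {suc n} (suc j) g = count-≟-∧ {n} j (g ∘ suc)

count-insert : (f g : Fin n → Bool) (j : Fin n) → f j ≡ false →
  count (λ x → (f x ∨ does (j ≟ x)) ∧ g x) ≡ b2n (g j) + count (λ x → f x ∧ g x)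
count-insert {n} f g j fj≡false = begin
  count (λ x → (f x ∨ does (j ≟ x)) ∧ g x)
    ≡⟨ +-identityʳ _ ⟨
  count (λ x → (f x ∨ does (j ≟ x)) ∧ g x) + 0
    ≡⟨ cong (count (λ x → (f x ∨ does (j ≟ x)) ∧ g x) +_) (count-false {n}) ⟨
  count (λ x → (f x ∨ does (j ≟ x)) ∧ g x) + count {n} (λ _ → false)
    ≡⟨ count-+-pointwise (λ x → pointwise (f x) (does (j ≟ x)) (g x) (disjoint x)) ⟩
  count (λ x → does (j ≟ x) ∧ g x) + count (λ x → f x ∧ g x)
    ≡⟨ cong (_+ _) (count-≟-∧ j g) ⟩
  b2n (g j) + count (λ x → f x ∧ g x) ∎
  where
  open ≡-Reasoning
  disjoint : ∀ x → f x ∧ does (j ≟ x) ≡ false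
  disjoint x with j ≟ x
  ... | yes refl = cong (_∧ true) fj≡false
  ... | no _     = ∧-zeroʳ (f x)
  pointwise : ∀ a d b → a ∧ d ≡ false → b2n ((a ∨ d) ∧ b) + b2n false ≡ b2n (d ∧ b) + b2n (a ∧ b)
  pointwise true  true  b     ()
  pointwise true  false true  _ = refl
  pointwise true  false false _ = refl
  pointwise false true  true  _ = refl
  pointwise false true  false _ = refl
  pointwise false false b     _ = refl

count-not-∧-not : (f g : Fin n → Bool) →
  count (λ x → not (f x) ∧ not (g x)) + (count f + count g) ≡ n + count (λ x → f x ∧ g x)
count-not-∧-not {n} f g = begin
  count (λ x → not (f x) ∧ not (g x)) + (count f + count g)
    ≡⟨ cong₂ _+_ (count-cong λ x → deMorgan₂ (f x) (g x)) (count-∨-∧ f g) ⟨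
  count (λ x → not (f x ∨ g x)) + (count (λ x → f x ∨ g x) + count (λ x → f x ∧ g x))
    ≡⟨ +-assoc (count (λ x → not (f x ∨ g x))) _ _ ⟨
  count (λ x → not (f x ∨ g x)) + count (λ x → f x ∨ g x) + count (λ x → f x ∧ g x)
    ≡⟨ cong (_+ count (λ x → f x ∧ g x)) (count-not (λ x → f x ∨ g x)) ⟩
  n + count (λ x → f x ∧ g x) ∎
  where open ≡-Reasoning

-- Sums over Fin

sum-const : ∀ m c → sum {m} (λ _ → c) ≡ m * c
sum-const zero    c = refl
sum-const (suc m) c = cong (c +_) (sum-const m c)

sum-except₁ : (f : Fin (suc m) → ℕ) (i : Fin (suc m)) {c : ℕ} →
  (∀ x → x ≢ i → f x ≡ c) → sum f ≡ f i + m * c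
sum-except₁ {m} f i {c} f≡c = begin
  sum f                         ≡⟨ sum-remove f ⟩
  f i + sum (f ∘ punchIn i)     ≡⟨ cong (f i +_) (sum-cong-≗ λ x → f≡c _ (punchInᵢ≢i i x)) ⟩
  f i + sum {m} (λ _ → c)       ≡⟨ cong (f i +_) (sum-const m c) ⟩
  f i + m * c                   ∎
  where open ≡-Reasoning

sum-except₂ : (f : Fin (suc (suc m)) → ℕ) {i i′ : Fin (suc (suc m))} {c : ℕ} → i ≢ i′ →
  (∀ x → x ≢ i → x ≢ i′ → f x ≡ c) → sum f ≡ f i + (f i′ + m * c)
sum-except₂ {m} f {i} {i′} {c} i≢i′ f≡c = begin
  sum f                            ≡⟨ sum-remove f ⟩
  f i + sum (f ∘ punchIn i)        ≡⟨ cong (f i +_) (sum-except₁ (f ∘ punchIn i) k rest≡c) ⟩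
  f i + (f (punchIn i k) + m * c)  ≡⟨ cong (λ y → f i + (f y + m * c)) (punchIn-punchOut i≢i′) ⟩
  f i + (f i′ + m * c)             ∎
  where
  open ≡-Reasoning
  k = punchOut i≢i′
  rest≡c : ∀ x → x ≢ k → f (punchIn i x) ≡ c
  rest≡c x x≢k = f≡c _ (punchInᵢ≢i i x)
    λ eq → x≢k (punchIn-injective i x k (trans eq (sym (punchIn-punchOut i≢i′))))

count-↑ : ∀ k {l} (f : Fin (k + l) → Bool) → count f ≡ count (λ i → f (i ↑ˡ l)) + count (λ i → f (k ↑ʳ i))
count-↑ zero    f = refl
count-↑ (suc k) f = trans (cong (b2n (f zero) +_) (count-↑ k (f ∘ suc))) (sym (+-assoc (b2n (f zero)) _ _))

count-remQuot : ∀ m (g : Fin m × Fin n → Bool) →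
  count (g ∘ remQuot {m} n) ≡ sum (λ i → count (λ j → g (i , j)))
count-remQuot zero    g = refl
count-remQuot {n} (suc m) g = begin
  count (g ∘ remQuot {suc m} n)
    ≡⟨ count-↑ n (g ∘ remQuot {suc m} n) ⟩
  count (λ j → g (remQuot {suc m} n (j ↑ˡ m * n))) + count (λ q → g (remQuot {suc m} n (n ↑ʳ q)))
    ≡⟨ cong₂ _+_ (count-cong λ j → cong g (remQuot-↑ˡ j)) (count-cong λ q → cong g (remQuot-↑ʳ q)) ⟩
  count (λ j → g (zero , j)) + count (λ q → g (suc (proj₁ (remQuot {m} n q)) , proj₂ (remQuot {m} n q)))
    ≡⟨ cong (count (λ j → g (zero , j)) +_) (count-remQuot m (λ p → g (suc (proj₁ p) , proj₂ p))) ⟩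
  count (λ j → g (zero , j)) + sum (λ i → count (λ j → g (suc i , j))) ∎
  where
  open ≡-Reasoning
  remQuot-↑ˡ : ∀ j → remQuot {suc m} n (j ↑ˡ m * n) ≡ (zero , j)
  remQuot-↑ˡ j rewrite splitAt-↑ˡ n j (m * n) = refl
  remQuot-↑ʳ : ∀ q → remQuot {suc m} n (n ↑ʳ q) ≡ (suc (proj₁ (remQuot {m} n q)) , proj₂ (remQuot {m} n q))
  remQuot-↑ʳ q rewrite splitAt-↑ʳ n (m * n) q = refl

blockSize≡sum : ∀ {m n b} (N : Incidence m n b) B → blockSize N B ≡ sum (λ i → count (λ j → N (i , j) B))
blockSize≡sum {zero}  N B = refl
blockSize≡sum {suc m} N B = cong (count (λ j → N (zero , j) B) +_) (blockSize≡sum {m} (λ p → N (suc (proj₁ p) , proj₂ p)) B)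

IsRD-cong : ∀ {m n b r k λ₁ λ₂ λ₃} {N N′ : Incidence m n b} → (∀ x B → N x B ≡ N′ x B) →
  IsRD m n b r k λ₁ λ₂ λ₃ N → IsRD m n b r k λ₁ λ₂ λ₃ N′
IsRD-cong {N = N} {N′} N≗N′ (rep , size , same-row , same-col , other) =
    (λ x → trans (sym (count-cong (N≗N′ x))) (rep x))
  , (λ B → trans (blockSize≡sum N′ B) (trans (sum-cong-≗ λ i → sym (count-cong λ j → N≗N′ (i , j) B))
                                             (trans (sym (blockSize≡sum N B)) (size B))))
  , (λ i j j′ j≢j′ → trans (sym (concurrence-cong _ _)) (same-row i j j′ j≢j′))
  , (λ i i′ j i≢i′ → trans (sym (concurrence-cong _ _)) (same-col i i′ j i≢i′))
  , (λ i i′ j j′ i≢i′ j≢j′ → trans (sym (concurrence-cong _ _)) (other i i′ j j′ i≢i′ j≢j′))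
  where
  concurrence-cong : ∀ x y → concurrence N x y ≡ concurrence N′ x y
  concurrence-cong x y = count-cong λ B → cong₂ _∧_ (N≗N′ x B) (N≗N′ y B)

-- Rectangular designs from block matrices

-- I_m ⊗ A + (J_m − I_m) ⊗ C, with block q : Fin (m * n) of the array read as the cell remQuot n q.
kroneckerEntry : ∀ {m n} (A C : Fin n → Fin n → Bool) → Fin m × Fin n → Fin m × Fin n → Bool
kroneckerEntry A C (i , j) (i′ , B) = if does (i ≟ i′) then A j B else C j B

kronecker : ∀ {m n} (A C : Fin n → Fin n → Bool) → Incidence m n (m * n)
kronecker {m} {n} A C x q = kroneckerEntry A C x (remQuot {m} n q)

record IsBalancedPair {n} (r₀ λ₀ μ ν : ℕ) (A C : Fin n → Fin n → Bool) : Set where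
  field
    rowSum-A    : ∀ j → count (A j) ≡ r₀
    rowSum-C    : ∀ j → count (C j) ≡ r₀
    columnSum-A : ∀ B → count (λ j → A j B) ≡ r₀
    columnSum-C : ∀ B → count (λ j → C j B) ≡ r₀
    inner-AA    : ∀ j j′ → j ≢ j′ → count (λ B → A j B ∧ A j′ B) ≡ λ₀
    inner-CC    : ∀ j j′ → j ≢ j′ → count (λ B → C j B ∧ C j′ B) ≡ λ₀
    inner-AC    : ∀ j → count (λ B → A j B ∧ C j B) ≡ μ
    inner-AC+CA : ∀ j j′ → j ≢ j′ →
                  count (λ B → A j B ∧ C j′ B) + count (λ B → C j B ∧ A j′ B) ≡ ν

module _ {n r₀ λ₀ μ ν} {A C : Fin n → Fin n → Bool} (pair : IsBalancedPair r₀ λ₀ μ ν A C) where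
  open IsBalancedPair pair

  private
    entry-same : ∀ {m} (i : Fin m) j B → kroneckerEntry A C (i , j) (i , B) ≡ A j B
    entry-same i j B rewrite dec-true (i ≟ i) refl = refl

    entry-diff : ∀ {m} {i i′ : Fin m} j B → i ≢ i′ → kroneckerEntry A C (i , j) (i′ , B) ≡ C j B
    entry-diff {i = i} {i′} j B i≢i′ rewrite dec-false (i ≟ i′) i≢i′ = refl

  kronecker-rowSum : ∀ {m} (i i′ : Fin m) j → count (λ B → kroneckerEntry A C (i , j) (i′ , B)) ≡ r₀
  kronecker-rowSum i i′ j with i ≟ i′
  ... | yes refl = rowSum-A j
  ... | no _     = rowSum-C j

  kronecker-columnSum : ∀ {m} (i i′ : Fin m) B → count (λ j → kroneckerEntry A C (i , j) (i′ , B)) ≡ r₀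
  kronecker-columnSum i i′ B with i ≟ i′
  ... | yes refl = columnSum-A B
  ... | no _     = columnSum-C B

  kronecker-classSize : ∀ {m} (k : Fin m) x →
    count (λ q → kronecker {m} A C x q ∧ isYes (proj₁ (remQuot {m} n q) ≟ k)) ≡ r₀
  kronecker-classSize {suc m} k x = begin
    count (λ q → kronecker {suc m} A C x q ∧ isYes (proj₁ (remQuot {suc m} n q) ≟ k))
      ≡⟨ count-remQuot (suc m) (λ p → kroneckerEntry {suc m} A C x p ∧ isYes (proj₁ p ≟ k)) ⟩
    sum inRow
      ≡⟨ sum-except₁ inRow k inOtherRow ⟩
    inRow k + m * 0
      ≡⟨ cong₂ _+_ inThisRow (*-zeroʳ m) ⟩
    r₀ + 0
      ≡⟨ +-identityʳ r₀ ⟩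
    r₀ ∎
    where
    open ≡-Reasoning
    inRow : Fin (suc m) → ℕ
    inRow i′ = count (λ B → kroneckerEntry {suc m} A C x (i′ , B) ∧ isYes (i′ ≟ k))
    inThisRow : inRow k ≡ r₀
    inThisRow = trans (count-cong λ B → trans (cong (kroneckerEntry A C x (k , B) ∧_)
                        (trans (isYes≗does (k ≟ k)) (dec-true (k ≟ k) refl))) (∧-identityʳ _))
                      (kronecker-rowSum (proj₁ x) k (proj₂ x))
    inOtherRow : ∀ i′ → i′ ≢ k → inRow i′ ≡ 0
    inOtherRow i′ i′≢k = trans (count-cong λ B → trans (cong (kroneckerEntry A C x (i′ , B) ∧_)
                                 (trans (isYes≗does (i′ ≟ k)) (dec-false (i′ ≟ k) i′≢k))) (∧-zeroʳ _))
                               (count-false {n})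

  kronecker-resolvable : ∀ {m} → IsResolvable r₀ (kronecker {m} {n} A C)
  kronecker-resolvable {m} = m , (λ q → proj₁ (remQuot {m} n q)) , kronecker-classSize

  private
    rowInner : ∀ {m} (x y : Fin m × Fin n) → Fin m → ℕ
    rowInner x y i″ = count (λ B → kroneckerEntry A C x (i″ , B) ∧ kroneckerEntry A C y (i″ , B))

    inner≡ : ∀ {m} {x y : Fin m × Fin n} {i″} {P Q : Fin n → Bool} →
      (∀ B → kroneckerEntry A C x (i″ , B) ≡ P B) → (∀ B → kroneckerEntry A C y (i″ , B) ≡ Q B) →
      rowInner x y i″ ≡ count (λ B → P B ∧ Q B)
    inner≡ x≗P y≗Q = count-cong λ B → cong₂ _∧_ (x≗P B) (y≗Q B)

    rowInner-AA : ∀ {m} (i : Fin m) j j′ → rowInner (i , j) (i , j′) i ≡ count (λ B → A j B ∧ A j′ B)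
    rowInner-AA i j j′ = inner≡ {x = i , j} {i , j′} (entry-same i j) (entry-same i j′)

    rowInner-AC : ∀ {m} {i i′ : Fin m} j j′ → i ≢ i′ → rowInner (i , j) (i′ , j′) i ≡ count (λ B → A j B ∧ C j′ B)
    rowInner-AC {i = i} {i′} j j′ i≢i′ = inner≡ {x = i , j} {i′ , j′} (entry-same i j) (λ B → entry-diff j′ B (i≢i′ ∘ sym))

    rowInner-CA : ∀ {m} {i i′ : Fin m} j j′ → i ≢ i′ → rowInner (i , j) (i′ , j′) i′ ≡ count (λ B → C j B ∧ A j′ B)
    rowInner-CA {i = i} {i′} j j′ i≢i′ = inner≡ {x = i , j} {i′ , j′} (λ B → entry-diff j B i≢i′) (entry-same i′ j′)

    rowInner-CC : ∀ {m} {i i′ i″ : Fin m} j j′ → i″ ≢ i → i″ ≢ i′ →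
      rowInner (i , j) (i′ , j′) i″ ≡ count (λ B → C j B ∧ C j′ B)
    rowInner-CC {i = i} {i′} j j′ i″≢i i″≢i′ =
      inner≡ {x = i , j} {i′ , j′} (λ B → entry-diff j B (i″≢i ∘ sym)) (λ B → entry-diff j′ B (i″≢i′ ∘ sym))

    concurrence≡sum : ∀ {m} (x y : Fin m × Fin n) → concurrence (kronecker A C) x y ≡ sum (rowInner x y)
    concurrence≡sum {m} x y = count-remQuot m (λ p → kroneckerEntry A C x p ∧ kroneckerEntry A C y p)

  kronecker-isRD : ∀ a {r λ₁ λ₂ λ₃} →
    r ≡ (2 + a) * r₀ → λ₁ ≡ (2 + a) * λ₀ → λ₂ ≡ μ + (μ + a * r₀) → λ₃ ≡ ν + a * λ₀ →
    IsRD (2 + a) n ((2 + a) * n) r r λ₁ λ₂ λ₃ (kronecker A C)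
  kronecker-isRD a refl refl refl refl = replicated , size , sameRow , sameColumn , elsewhere
    where
    open ≡-Reasoning

    replicated : ∀ x → replication (kronecker A C) x ≡ (2 + a) * r₀
    replicated x@(i , j) = begin
      count (kronecker A C x)                                  ≡⟨ count-remQuot (2 + a) (kroneckerEntry A C x) ⟩
      sum (λ i′ → count (λ B → kroneckerEntry A C x (i′ , B)))  ≡⟨ sum-cong-≗ (λ i′ → kronecker-rowSum i i′ j) ⟩
      sum {2 + a} (λ _ → r₀)                                   ≡⟨ sum-const (2 + a) r₀ ⟩
      (2 + a) * r₀                                             ∎

    size : ∀ q → blockSize (kronecker A C) q ≡ (2 + a) * r₀
    size q = begin
      blockSize (kronecker A C) q
        ≡⟨ blockSize≡sum (kronecker A C) q ⟩
      sum (λ i → count (λ j → kroneckerEntry A C (i , j) (remQuot {2 + a} n q)))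
        ≡⟨ sum-cong-≗ (λ i → kronecker-columnSum i (proj₁ (remQuot {2 + a} n q)) (proj₂ (remQuot {2 + a} n q))) ⟩
      sum {2 + a} (λ _ → r₀)
        ≡⟨ sum-const (2 + a) r₀ ⟩
      (2 + a) * r₀ ∎

    sameRow : ∀ i j j′ → j ≢ j′ → concurrence (kronecker A C) (i , j) (i , j′) ≡ (2 + a) * λ₀
    sameRow i j j′ j≢j′ = begin
      concurrence (kronecker A C) (i , j) (i , j′) ≡⟨ concurrence≡sum (i , j) (i , j′) ⟩
      sum (rowInner (i , j) (i , j′))            ≡⟨ sum-except₁ _ i otherRow ⟩
      rowInner (i , j) (i , j′) i + suc a * λ₀   ≡⟨ cong (_+ suc a * λ₀) thisRow ⟩
      λ₀ + suc a * λ₀                            ∎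
      where
      thisRow : rowInner (i , j) (i , j′) i ≡ λ₀
      thisRow = trans (rowInner-AA i j j′) (inner-AA j j′ j≢j′)
      otherRow : ∀ i″ → i″ ≢ i → rowInner (i , j) (i , j′) i″ ≡ λ₀
      otherRow i″ i″≢i = trans (rowInner-CC j j′ i″≢i i″≢i) (inner-CC j j′ j≢j′)

    sameColumn : ∀ i i′ j → i ≢ i′ → concurrence (kronecker A C) (i , j) (i′ , j) ≡ μ + (μ + a * r₀)
    sameColumn i i′ j i≢i′ = begin
      concurrence (kronecker A C) (i , j) (i′ , j)                            ≡⟨ concurrence≡sum (i , j) (i′ , j) ⟩
      sum (rowInner (i , j) (i′ , j))                                        ≡⟨ sum-except₂ _ i≢i′ otherRow ⟩
      rowInner (i , j) (i′ , j) i + (rowInner (i , j) (i′ , j) i′ + a * r₀) ≡⟨ cong₂ (λ u v → u + (v + a * r₀)) row-i row-i′ ⟩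
      μ + (μ + a * r₀)                                                      ∎
      where
      row-i : rowInner (i , j) (i′ , j) i ≡ μ
      row-i = trans (rowInner-AC j j i≢i′) (inner-AC j)
      row-i′ : rowInner (i , j) (i′ , j) i′ ≡ μ
      row-i′ = trans (rowInner-CA j j i≢i′) (trans (count-cong λ B → ∧-comm (C j B) (A j B)) (inner-AC j))
      otherRow : ∀ i″ → i″ ≢ i → i″ ≢ i′ → rowInner (i , j) (i′ , j) i″ ≡ r₀
      otherRow i″ i″≢i i″≢i′ = trans (rowInner-CC j j i″≢i i″≢i′) (trans (count-cong λ B → ∧-idem (C j B)) (rowSum-C j))

    elsewhere : ∀ i i′ j j′ → i ≢ i′ → j ≢ j′ → concurrence (kronecker A C) (i , j) (i′ , j′) ≡ ν + a * λ₀
    elsewhere i i′ j j′ i≢i′ j≢j′ = begin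
      concurrence (kronecker A C) (i , j) (i′ , j′)                              ≡⟨ concurrence≡sum (i , j) (i′ , j′) ⟩
      sum (rowInner (i , j) (i′ , j′))                                          ≡⟨ sum-except₂ _ i≢i′ otherRow ⟩
      rowInner (i , j) (i′ , j′) i + (rowInner (i , j) (i′ , j′) i′ + a * λ₀)  ≡⟨ +-assoc (rowInner (i , j) (i′ , j′) i) _ (a * λ₀) ⟨
      rowInner (i , j) (i′ , j′) i + rowInner (i , j) (i′ , j′) i′ + a * λ₀    ≡⟨ cong (_+ a * λ₀) rows-i-i′ ⟩
      ν + a * λ₀                                                               ∎
      where
      rows-i-i′ : rowInner (i , j) (i′ , j′) i + rowInner (i , j) (i′ , j′) i′ ≡ ν
      rows-i-i′ = trans (cong₂ _+_ (rowInner-AC j j′ i≢i′) (rowInner-CA j j′ i≢i′)) (inner-AC+CA j j′ j≢j′)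
      otherRow : ∀ i″ → i″ ≢ i → i″ ≢ i′ → rowInner (i , j) (i′ , j′) i″ ≡ λ₀
      otherRow i″ i″≢i i″≢i′ = trans (rowInner-CC j j′ i″≢i i″≢i′) (inner-CC j j′ j≢j′)

-- Skew-Hadamard designs

reflexiveClosure : (Fin n → Fin n → Bool) → Fin n → Fin n → Bool
reflexiveClosure N j B = N j B ∨ does (j ≟ B)

complement : (Fin n → Fin n → Bool) → Fin n → Fin n → Bool
complement N j B = not (N j B)

skewHadamardRD : ∀ {m n} → (Fin n → Fin n → Bool) → Incidence m n (m * n)
skewHadamardRD N = kronecker (reflexiveClosure N) (complement N)

4t∸1≡ : ∀ c → 4 * suc c ∸ 1 ≡ 3 + 4 * c
4t∸1≡ c = cong pred (lemma c)
  where
  lemma : ∀ c → 4 * suc c ≡ suc (3 + 4 * c)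
  lemma = solve-∀

2t∸1≡ : ∀ c → 2 * suc c ∸ 1 ≡ 1 + 2 * c
2t∸1≡ c = cong pred (lemma c)
  where
  lemma : ∀ c → 2 * suc c ≡ suc (1 + 2 * c)
  lemma = solve-∀

-- Written with c = t − 1, so that v = 3 + 4c, k = 1 + 2c and λ = c are free of truncated subtraction.
module SkewHadamard {c : ℕ} {N : Fin (4 * suc c ∸ 1) → Fin (4 * suc c ∸ 1) → Bool}
                    (skewHadamard : IsSkewHadamard (suc c) N) where

  private
    A = reflexiveClosure N
    v = 4 * suc c ∸ 1

  columnSum : ∀ B → count (λ x → N x B) ≡ 1 + 2 * c
  columnSum B = trans (proj₁ skewHadamard B) (2t∸1≡ c)

  rowConcurrence : ∀ j j′ → j ≢ j′ → count (λ B → N j B ∧ N j′ B) ≡ c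
  rowConcurrence = proj₁ (proj₂ skewHadamard)

  irreflexive : ∀ j → N j j ≡ false
  irreflexive j with N j j | proj₁ (proj₂ (proj₂ skewHadamard)) j
  ... | false | _ = refl

  tournament : ∀ j j′ → j ≢ j′ → b2n (N j j′) + b2n (N j′ j) ≡ 1
  tournament = proj₂ (proj₂ (proj₂ skewHadamard))

  closure≡not-transpose : ∀ j B → A j B ≡ not (N B j)
  closure≡not-transpose j B with j ≟ B
  ... | yes refl rewrite irreflexive j = refl
  ... | no j≢B with N j B | N B j | tournament j B j≢B
  ...   | true  | false | _ = refl
  ...   | false | true  | _ = refl

  transpose≡not-closure : ∀ j B → N B j ≡ not (A j B)
  transpose≡not-closure j B = trans (sym (not-involutive (N B j))) (cong not (sym (closure≡not-transpose j B)))

  closure-∧ : ∀ j (g : Fin v → Bool) → count (λ B → A j B ∧ g B) ≡ b2n (g j) + count (λ B → N j B ∧ g B)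
  closure-∧ j g = count-insert (N j) g j (irreflexive j)

  closure-rowSum≡suc : ∀ j → count (A j) ≡ suc (count (N j))
  closure-rowSum≡suc j = begin
    count (A j)                       ≡⟨ count-cong (λ B → ∧-identityʳ (A j B)) ⟨
    count (λ B → A j B ∧ true)        ≡⟨ closure-∧ j (λ _ → true) ⟩
    suc (count (λ B → N j B ∧ true))  ≡⟨ cong suc (count-cong λ B → ∧-identityʳ (N j B)) ⟩
    suc (count (N j))                 ∎
    where open ≡-Reasoning

  rowSum : ∀ j → count (N j) ≡ 1 + 2 * c
  rowSum j = +-cancelʳ-≡ (2 + 2 * c) _ _ (begin
    count (N j) + (2 + 2 * c)                        ≡⟨ shuffle (count (N j)) c ⟩
    (1 + 2 * c) + suc (count (N j))                  ≡⟨ cong₂ _+_ (columnSum j) (closure-rowSum≡suc j) ⟨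
    count (λ B → N B j) + count (A j)                ≡⟨ cong (_+ count (A j)) (count-cong (transpose≡not-closure j)) ⟩
    count (λ B → not (A j B)) + count (A j)          ≡⟨ count-not (A j) ⟩
    v                                                ≡⟨ 4t∸1≡ c ⟩
    3 + 4 * c                                        ≡⟨ split c ⟩
    (1 + 2 * c) + (2 + 2 * c)                        ∎)
    where
    open ≡-Reasoning
    shuffle : ∀ r c → r + (2 + 2 * c) ≡ (1 + 2 * c) + suc r
    shuffle = solve-∀
    split : ∀ c → 3 + 4 * c ≡ (1 + 2 * c) + (2 + 2 * c)
    split = solve-∀

  closure-rowSum : ∀ j → count (A j) ≡ 2 + 2 * c
  closure-rowSum j = trans (closure-rowSum≡suc j) (cong suc (rowSum j))

  complement-rowSum : ∀ j → count (λ B → not (N j B)) ≡ 2 + 2 * c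
  complement-rowSum j = +-cancelʳ-≡ (1 + 2 * c) _ _ (begin
    count (λ B → not (N j B)) + (1 + 2 * c)    ≡⟨ cong (count (λ B → not (N j B)) +_) (rowSum j) ⟨
    count (λ B → not (N j B)) + count (N j)    ≡⟨ count-not (N j) ⟩
    v                                          ≡⟨ 4t∸1≡ c ⟩
    3 + 4 * c                                  ≡⟨ split c ⟩
    (2 + 2 * c) + (1 + 2 * c)                  ∎)
    where
    open ≡-Reasoning
    split : ∀ c → 3 + 4 * c ≡ (2 + 2 * c) + (1 + 2 * c)
    split = solve-∀

  complement-columnSum : ∀ B → count (λ j → not (N j B)) ≡ 2 + 2 * c
  complement-columnSum B = +-cancelʳ-≡ (1 + 2 * c) _ _ (begin
    count (λ j → not (N j B)) + (1 + 2 * c)          ≡⟨ cong (count (λ j → not (N j B)) +_) (columnSum B) ⟨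
    count (λ j → not (N j B)) + count (λ j → N j B)  ≡⟨ count-not (λ j → N j B) ⟩
    v                                                ≡⟨ 4t∸1≡ c ⟩
    3 + 4 * c                                        ≡⟨ split c ⟩
    (2 + 2 * c) + (1 + 2 * c)                        ∎)
    where
    open ≡-Reasoning
    split : ∀ c → 3 + 4 * c ≡ (2 + 2 * c) + (1 + 2 * c)
    split = solve-∀

  closure-columnSum : ∀ B → count (λ j → A j B) ≡ 2 + 2 * c
  closure-columnSum B = trans (count-cong λ j → closure≡not-transpose j B) (complement-rowSum B)

  closure-∧-row : ∀ j j′ → j ≢ j′ → count (λ B → A j B ∧ N j′ B) ≡ b2n (N j′ j) + c
  closure-∧-row j j′ j≢j′ = trans (closure-∧ j (N j′)) (cong (b2n (N j′ j) +_) (rowConcurrence j j′ j≢j′))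

  closure-inner : ∀ j j′ → j ≢ j′ → count (λ B → A j B ∧ A j′ B) ≡ suc c
  closure-inner j j′ j≢j′ = begin
    count (λ B → A j B ∧ A j′ B)                   ≡⟨ closure-∧ j (A j′) ⟩
    b2n (A j′ j) + count (λ B → N j B ∧ A j′ B)    ≡⟨ cong₂ _+_ (cong b2n off-diagonal) (count-cong λ B → ∧-comm (N j B) (A j′ B)) ⟩
    b2n (N j′ j) + count (λ B → A j′ B ∧ N j B)    ≡⟨ cong (b2n (N j′ j) +_) (closure-∧-row j′ j (j≢j′ ∘ sym)) ⟩
    b2n (N j′ j) + (b2n (N j j′) + c)              ≡⟨ +-assoc (b2n (N j′ j)) _ c ⟨
    b2n (N j′ j) + b2n (N j j′) + c                ≡⟨ cong (_+ c) (tournament j′ j (j≢j′ ∘ sym)) ⟩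
    suc c                                          ∎
    where
    open ≡-Reasoning
    off-diagonal : A j′ j ≡ N j′ j
    off-diagonal rewrite dec-false (j′ ≟ j) (j≢j′ ∘ sym) = ∨-identityʳ (N j′ j)

  complement-inner : ∀ j j′ → j ≢ j′ → count (λ B → not (N j B) ∧ not (N j′ B)) ≡ suc c
  complement-inner j j′ j≢j′ = +-cancelʳ-≡ (2 + 4 * c) _ _ (begin
    X + (2 + 4 * c)                      ≡⟨ cong (X +_) (split c) ⟩
    X + ((1 + 2 * c) + (1 + 2 * c))      ≡⟨ cong (X +_) (cong₂ _+_ (rowSum j) (rowSum j′)) ⟨
    X + (count (N j) + count (N j′))     ≡⟨ count-not-∧-not (N j) (N j′) ⟩
    v + count (λ B → N j B ∧ N j′ B)     ≡⟨ cong₂ _+_ (4t∸1≡ c) (rowConcurrence j j′ j≢j′) ⟩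
    (3 + 4 * c) + c                      ≡⟨ merge c ⟩
    suc c + (2 + 4 * c)                  ∎)
    where
    open ≡-Reasoning
    X = count (λ B → not (N j B) ∧ not (N j′ B))
    split : ∀ c → 2 + 4 * c ≡ (1 + 2 * c) + (1 + 2 * c)
    split = solve-∀
    merge : ∀ c → (3 + 4 * c) + c ≡ suc c + (2 + 4 * c)
    merge = solve-∀

  columnConcurrence : ∀ B B′ → B ≢ B′ → count (λ x → N x B ∧ N x B′) ≡ c
  columnConcurrence B B′ B≢B′ = +-cancelʳ-≡ (4 + 4 * c) _ _ (begin
    X + (4 + 4 * c)                          ≡⟨ cong (X +_) (split c) ⟩
    X + ((2 + 2 * c) + (2 + 2 * c))          ≡⟨ cong (X +_) (cong₂ _+_ (closure-rowSum B) (closure-rowSum B′)) ⟨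
    X + (count (A B) + count (A B′))         ≡⟨ cong (_+ (count (A B) + count (A B′)))
                                                   (count-cong λ x → cong₂ _∧_ (transpose≡not-closure B x) (transpose≡not-closure B′ x)) ⟩
    count (λ x → not (A B x) ∧ not (A B′ x)) + (count (A B) + count (A B′))
                                             ≡⟨ count-not-∧-not (A B) (A B′) ⟩
    v + count (λ x → A B x ∧ A B′ x)         ≡⟨ cong₂ _+_ (4t∸1≡ c) (closure-inner B B′ B≢B′) ⟩
    (3 + 4 * c) + suc c                      ≡⟨ merge c ⟩
    c + (4 + 4 * c)                          ∎)
    where
    open ≡-Reasoning
    X = count (λ x → N x B ∧ N x B′)
    split : ∀ c → 4 + 4 * c ≡ (2 + 2 * c) + (2 + 2 * c)
    split = solve-∀
    merge : ∀ c → (3 + 4 * c) + suc c ≡ c + (4 + 4 * c)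
    merge = solve-∀

  closure-complement-inner : ∀ j → count (λ B → A j B ∧ not (N j B)) ≡ 1
  closure-complement-inner j = +-cancelʳ-≡ (1 + 2 * c) _ _ (begin
    X + (1 + 2 * c)                       ≡⟨ cong (X +_) closure-∧-self ⟨
    X + count (λ B → A j B ∧ N j B)       ≡⟨ count-∧-not (A j) (N j) ⟩
    count (A j)                           ≡⟨ closure-rowSum j ⟩
    1 + (1 + 2 * c)                       ∎)
    where
    open ≡-Reasoning
    X = count (λ B → A j B ∧ not (N j B))
    closure-∧-self : count (λ B → A j B ∧ N j B) ≡ 1 + 2 * c
    closure-∧-self = begin
      count (λ B → A j B ∧ N j B)               ≡⟨ closure-∧ j (N j) ⟩
      b2n (N j j) + count (λ B → N j B ∧ N j B) ≡⟨ cong₂ _+_ (cong b2n (irreflexive j)) (count-cong λ B → ∧-idem (N j B)) ⟩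
      count (N j)                               ≡⟨ rowSum j ⟩
      1 + 2 * c                                 ∎

  closure-complement-crossInner : ∀ j j′ → j ≢ j′ →
    count (λ B → A j B ∧ not (N j′ B)) + count (λ B → not (N j B) ∧ A j′ B) ≡ 3 + 2 * c
  closure-complement-crossInner j j′ j≢j′ = +-cancelʳ-≡ (1 + 2 * c) _ _ (begin
    X + Y + (1 + 2 * c)                                   ≡⟨ cong (λ u → X + Y + (u + 2 * c)) (tournament j′ j (j≢j′ ∘ sym)) ⟨
    X + Y + ((b2n (N j′ j) + b2n (N j j′)) + 2 * c)        ≡⟨ regroup X Y (b2n (N j′ j)) (b2n (N j j′)) c ⟩
    (X + (b2n (N j′ j) + c)) + (Y + (b2n (N j j′) + c))    ≡⟨ cong₂ _+_ (off j j′ j≢j′)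
                                                               (trans (cong (_+ (b2n (N j j′) + c)) (count-cong λ B → ∧-comm (not (N j B)) (A j′ B)))
                                                                      (off j′ j (j≢j′ ∘ sym))) ⟩
    (2 + 2 * c) + (2 + 2 * c)                              ≡⟨ split c ⟩
    (3 + 2 * c) + (1 + 2 * c)                              ∎)
    where
    open ≡-Reasoning
    X = count (λ B → A j B ∧ not (N j′ B))
    Y = count (λ B → not (N j B) ∧ A j′ B)
    off : ∀ j j′ → j ≢ j′ → count (λ B → A j B ∧ not (N j′ B)) + (b2n (N j′ j) + c) ≡ 2 + 2 * c
    off j j′ j≢j′ = trans (cong (count (λ B → A j B ∧ not (N j′ B)) +_) (sym (closure-∧-row j j′ j≢j′))) (trans (count-∧-not (A j) (N j′)) (closure-rowSum j))
    regroup : ∀ x y p q c → x + y + ((p + q) + 2 * c) ≡ (x + (p + c)) + (y + (q + c))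
    regroup = solve-∀
    split : ∀ c → (2 + 2 * c) + (2 + 2 * c) ≡ (3 + 2 * c) + (1 + 2 * c)
    split = solve-∀

  balancedPair : IsBalancedPair (2 + 2 * c) (suc c) 1 (3 + 2 * c) (reflexiveClosure N) (complement N)
  balancedPair = record
    { rowSum-A    = closure-rowSum
    ; rowSum-C    = complement-rowSum
    ; columnSum-A = closure-columnSum
    ; columnSum-C = complement-columnSum
    ; inner-AA    = closure-inner
    ; inner-CC    = complement-inner
    ; inner-AC    = closure-complement-inner
    ; inner-AC+CA = closure-complement-crossInner
    }

skewHadamard-transpose : ∀ {t} {N : Fin (4 * t ∸ 1) → Fin (4 * t ∸ 1) → Bool} →
  IsSkewHadamard t N → IsSkewHadamard t (flip N)
skewHadamard-transpose {zero}  _            = (λ ()) , (λ ()) , (λ ()) , (λ ())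
skewHadamard-transpose {suc c} skewHadamard =
    (λ B → trans (rowSum B) (sym (2t∸1≡ c)))
  , columnConcurrence
  , proj₁ (proj₂ (proj₂ skewHadamard))
  , λ x y x≢y → tournament y x (x≢y ∘ sym)
  where open SkewHadamard skewHadamard

does-≟-sym : (x y : Fin n) → does (x ≟ y) ≡ does (y ≟ x)
does-≟-sym x y with x ≟ y | y ≟ x
... | yes refl | yes _    = refl
... | no _     | no _     = refl
... | yes refl | no y≢x   = ⊥-elim (y≢x refl)
... | no x≢y   | yes refl = ⊥-elim (x≢y refl)

dual-skewHadamardRD : ∀ {m n} (N : Fin n → Fin n → Bool) p q →
  dual (skewHadamardRD {m} N) (↔-sym *↔×) p q ≡ skewHadamardRD (flip N) p q
dual-skewHadamardRD {m} {n} N (i , j) q =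
  trans (cong (kroneckerEntry (reflexiveClosure N) (complement N) (remQuot {m} n q)) (remQuot-combine i j))
        (entry-transpose (remQuot {m} n q))
  where
  entry-transpose : ∀ x → kroneckerEntry (reflexiveClosure N) (complement N) x (i , j)
                        ≡ kroneckerEntry (reflexiveClosure (flip N)) (complement (flip N)) (i , j) x
  entry-transpose (i′ , B) rewrite does-≟-sym i′ i | does-≟-sym B j = refl

skewHadamardRD-isRD : ∀ a {c N} → IsSkewHadamard (suc c) N →
  IsRD (2 + a) (4 * suc c ∸ 1) ((2 + a) * (4 * suc c ∸ 1)) (2 * (2 + a) * suc c) (2 * (2 + a) * suc c)
       ((2 + a) * suc c) (2 * suc c * a + 2) ((2 + a) * suc c + 1) (skewHadamardRD N)
skewHadamardRD-isRD a {c} skewHadamard =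
  kronecker-isRD (SkewHadamard.balancedPair skewHadamard) a (r≡ a c) refl (λ₂≡ a c) (λ₃≡ a c)
  where
  r≡ : ∀ a c → 2 * (2 + a) * suc c ≡ (2 + a) * (2 + 2 * c)
  r≡ = solve-∀
  λ₂≡ : ∀ a c → 2 * suc c * a + 2 ≡ 1 + (1 + a * (2 + 2 * c))
  λ₂≡ = solve-∀
  λ₃≡ : ∀ a c → (2 + a) * suc c + 1 ≡ 3 + 2 * c + a * suc c
  λ₃≡ = solve-∀

skewHadamardRD-resolvable : ∀ {m c N} → IsSkewHadamard (suc c) N → IsResolvable (2 * suc c) (skewHadamardRD {m} N)
skewHadamardRD-resolvable {m} {c} {N} skewHadamard =
  subst (λ α → IsResolvable α (skewHadamardRD {m} N)) (2+2c≡2t c)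
        (kronecker-resolvable (SkewHadamard.balancedPair skewHadamard))
  where
  2+2c≡2t : ∀ c → 2 + 2 * c ≡ 2 * suc c
  2+2c≡2t = solve-∀

-- The θ-values

private
  pos-+*+ : ∀ a b c d → pos (a + b * c + d) ≡ pos a ℤ.+ pos b ℤ.* pos c ℤ.+ pos d
  pos-+*+ a b c d = begin
    pos (a + b * c + d)                  ≡⟨ pos-+ (a + b * c) d ⟩
    pos (a + b * c) ℤ.+ pos d            ≡⟨ cong (ℤ._+ pos d) (pos-+ a (b * c)) ⟩
    pos a ℤ.+ pos (b * c) ℤ.+ pos d      ≡⟨ cong (λ z → pos a ℤ.+ z ℤ.+ pos d) (pos-* b c) ⟩
    pos a ℤ.+ pos b ℤ.* pos c ℤ.+ pos d  ∎
    where open ≡-Reasoning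

  shape₁ : ∀ (r m l₁ l₂ l₃ : ℤ) →
    (r ℤ.- l₁) ℤ.+ (m ℤ.- pos 1) ℤ.* (l₂ ℤ.- l₃) ≡ (r ℤ.+ m ℤ.* l₂ ℤ.+ l₃) ℤ.- (l₁ ℤ.+ m ℤ.* l₃ ℤ.+ l₂)
  shape₁ = ℤ-Solver.solve-∀

  shape₃ : ∀ (r l₁ l₂ l₃ : ℤ) → ((r ℤ.- l₁) ℤ.- l₂) ℤ.+ l₃ ≡ (r ℤ.+ l₃) ℤ.- (l₁ ℤ.+ l₂)
  shape₃ = ℤ-Solver.solve-∀

θ₁≡ : ∀ m n r λ₁ λ₂ λ₃ → θ₁ m n r λ₁ λ₂ λ₃ ≡ pos (r + m * λ₂ + λ₃) ℤ.- pos (λ₁ + m * λ₃ + λ₂)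
θ₁≡ m n r λ₁ λ₂ λ₃ = trans (shape₁ (pos r) (pos m) (pos λ₁) (pos λ₂) (pos λ₃))
                           (sym (cong₂ ℤ._-_ (pos-+*+ r m λ₂ λ₃) (pos-+*+ λ₁ m λ₃ λ₂)))

θ₂≡ : ∀ m n r λ₁ λ₂ λ₃ → θ₂ m n r λ₁ λ₂ λ₃ ≡ pos (r + n * λ₁ + λ₃) ℤ.- pos (λ₂ + n * λ₃ + λ₁)
θ₂≡ m n r λ₁ λ₂ λ₃ = trans (shape₁ (pos r) (pos n) (pos λ₂) (pos λ₁) (pos λ₃))
                           (sym (cong₂ ℤ._-_ (pos-+*+ r n λ₁ λ₃) (pos-+*+ λ₂ n λ₃ λ₁)))

θ₃≡ : ∀ m n r λ₁ λ₂ λ₃ → θ₃ m n r λ₁ λ₂ λ₃ ≡ pos (r + λ₃) ℤ.- pos (λ₁ + λ₂)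
θ₃≡ m n r λ₁ λ₂ λ₃ = trans (shape₃ (pos r) (pos λ₁) (pos λ₂) (pos λ₃))
                           (sym (cong₂ ℤ._-_ (pos-+ r λ₃) (pos-+ λ₁ λ₂)))

pos-minus : ∀ x {p q} → p ≡ x + q → pos p ℤ.- pos q ≡ pos x
pos-minus x {q = q} refl = trans (cong (ℤ._- pos q) (pos-+ x q)) (cancel (pos x) (pos q))
  where
  cancel : ∀ (x q : ℤ) → x ℤ.+ q ℤ.- q ≡ x
  cancel = ℤ-Solver.solve-∀

isSemiRegular : ∀ {m n r λ₁ λ₂ λ₃} x y →
  r + n * λ₁ + λ₃ ≡ 0 + (λ₂ + n * λ₃ + λ₁) →
  r + m * λ₂ + λ₃ ≡ suc x + (λ₁ + m * λ₃ + λ₂) →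
  r + λ₃ ≡ suc y + (λ₁ + λ₂) →
  IsSemiRegular m n r λ₁ λ₂ λ₃
isSemiRegular {m} {n} {r} {λ₁} {λ₂} {λ₃} x y θ₂-numerator θ₁-numerator θ₃-numerator =
  inj₂ ( trans (θ₂≡ m n r λ₁ λ₂ λ₃) (pos-minus 0 θ₂-numerator)
       , positive (trans (θ₁≡ m n r λ₁ λ₂ λ₃) (pos-minus (suc x) θ₁-numerator))
       , positive (trans (θ₃≡ m n r λ₁ λ₂ λ₃) (pos-minus (suc y) θ₃-numerator)) )
  where
  positive : ∀ {θ k} → θ ≡ pos (suc k) → pos 0 ℤ.< θ
  positive refl = +<+ (s≤s z≤n)

skewHadamardRD-semiRegular : ∀ a c →
  IsSemiRegular (2 + a) (4 * suc c ∸ 1) (2 * (2 + a) * suc c) ((2 + a) * suc c) (2 * suc c * a + 2) ((2 + a) * suc c + 1)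
skewHadamardRD-semiRegular a c rewrite 4t∸1≡ c =
  isSemiRegular {2 + a} {3 + 4 * c} {2 * (2 + a) * suc c} {(2 + a) * suc c} {2 * suc c * a + 2} {(2 + a) * suc c + 1}
    (a + suc c * a * a) (2 + 4 * c) (θ₂-numerator a c) (θ₁-numerator a c) (θ₃-numerator a c)
  where
  θ₂-numerator : ∀ a c → let m = 2 + a; t = suc c; n = 3 + 4 * c; λ₁ = m * t; λ₂ = 2 * t * a + 2; λ₃ = m * t + 1 in
    2 * m * t + n * λ₁ + λ₃ ≡ 0 + (λ₂ + n * λ₃ + λ₁)
  θ₂-numerator = solve-∀
  θ₁-numerator : ∀ a c → let m = 2 + a; t = suc c; λ₁ = m * t; λ₂ = 2 * t * a + 2; λ₃ = m * t + 1 in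
    2 * m * t + m * λ₂ + λ₃ ≡ suc (a + t * a * a) + (λ₁ + m * λ₃ + λ₂)
  θ₁-numerator = solve-∀
  θ₃-numerator : ∀ a c → let m = 2 + a; t = suc c; λ₁ = m * t; λ₂ = 2 * t * a + 2; λ₃ = m * t + 1 in
    2 * m * t + λ₃ ≡ (3 + 4 * c) + (λ₁ + λ₂)
  θ₃-numerator = solve-∀

corollary6 : (t : ℕ) → 1 ≤ t → SkewHadamardExists t →
    (m : ℕ) → 2 ≤ m →
    Σ (Incidence m (4 * t ∸ 1) (m * (4 * t ∸ 1))) λ N →
      IsSelfDualRD m (4 * t ∸ 1) (m * (4 * t ∸ 1)) (2 * m * t) (2 * m * t)
        (m * t) (2 * t * (m ∸ 2) + 2) (m * t + 1) N
      × IsSemiRegular m (4 * t ∸ 1) (2 * m * t) (m * t) (2 * t * (m ∸ 2) + 2) (m * t + 1)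
      × IsResolvable (2 * t) N
corollary6 (suc c) (s≤s z≤n) (N , skewHadamard) (suc (suc a)) (s≤s (s≤s z≤n)) =
    skewHadamardRD N
  , ( skewHadamardRD-isRD a skewHadamard
    , refl
    , ↔-sym *↔×
    , IsRD-cong (λ p q → sym (dual-skewHadamardRD N p q))
                (skewHadamardRD-isRD a (skewHadamard-transpose {suc c} {N} skewHadamard)) )
  , skewHadamardRD-semiRegular a c
  , skewHadamardRD-resolvable skewHadamard
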